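{- Let $\nu\ge1$, $a=2^\nu+1$, $b=2^\nu-1$, and let $T:\mathbb{N}\to\mathbb{N}$ be defined by $T(n)=n/2$ if $n$ is even and $T(n)=(an+b)/2$ if $n$ is odd. For $n\in\mathbb{N}$ define $s(n)=\sup_{k\ge0}T^{(k)}(n)/n$ if the trajectory $\{T^{(k)}(n)\}_{k\ge0}$ is bounded and $s(n)=+\infty$ if $\lim_{k\to\infty}T^{(k)}(n)=\infty$. Then the sequence $(s(n))_{n\in\mathbb{N}}$ is unbounded.
   Context: $T^{(k)}$ denotes the $k$-th iterate of $T$. -}

module Defs where

open import Data.Nat using (ℕ; zero; suc; _+_; _*_; _∸_; _^_)
open import Data.Nat.DivMod using (_/_; _%_)
open import Data.Bool using (if_then_else_)
open import Data.Nat using (_≡ᵇ_)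

aν : ℕ → ℕ
aν ν = 2 ^ ν + 1

bν : ℕ → ℕ
bν ν = 2 ^ ν ∸ 1

T : ℕ → ℕ → ℕ
T ν n = if (n % 2 ≡ᵇ 0) then n / 2 else (aν ν * n + bν ν) / 2

iter : (ℕ → ℕ) → ℕ → ℕ → ℕ
iter f zero    x = x
iter f (suc k) x = f (iter f k x)

{-# OPTIONS --safe #-}
module Submission where

-- The shift n ↦ n + 1 conjugates the odd branch of T to multiplication by a/2,
-- because a − b = 2.  Hence if n + 1 = 2^k w then T^(k)(n) + 1 = a^k w, and
-- n = 2^k − 1 climbs to T^(k)(n) = a^k − 1 ≥ 3^k − 1.  As (3/2)^k outgrows any
-- linear function of k, taking k = 2M + 2 gives T^(k)(n) > M n.

open import Defs
open import Data.Nat using (ℕ; _*_; _<_; _≥_)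
open import Data.Product using (Σ; _×_; ∃-syntax)
open import Data.Nat using (suc; _+_; _∸_; _^_; _≤_; s≤s; z≤n)
open import Data.Nat.Properties
open import Data.Nat.DivMod using (_/_; _%_; m*n/n≡m; [m+kn]%n≡m%n)
open import Data.Product using (_,_)
open import Data.Nat.Tactic.RingSolver using (solve-∀)
open import Data.Empty using (⊥-elim)
open import Relation.Binary.PropositionalEquality

[[P+1]*[1+z*2]+[P∸1]]/2+1≡[P+1]*[1+z] : ∀ P z → 1 ≤ P →
  ((P + 1) * (1 + z * 2) + (P ∸ 1)) / 2 + 1 ≡ (P + 1) * suc z
[[P+1]*[1+z*2]+[P∸1]]/2+1≡[P+1]*[1+z] (suc p) z _ = begin
    ((suc p + 1) * (1 + z * 2) + p) / 2 + 1    ≡⟨ cong (λ t → t / 2 + 1) (numerator p z) ⟩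
    ((suc p + (suc p + 1) * z) * 2) / 2 + 1    ≡⟨ cong (_+ 1) (m*n/n≡m (suc p + (suc p + 1) * z) 2) ⟩
    suc p + (suc p + 1) * z + 1                ≡⟨ regroup p z ⟩
    (suc p + 1) * suc z                        ∎
  where
  open ≡-Reasoning
  numerator : ∀ p z → (suc p + 1) * (1 + z * 2) + p ≡ (suc p + (suc p + 1) * z) * 2
  numerator = solve-∀
  regroup : ∀ p z → suc p + (suc p + 1) * z + 1 ≡ (suc p + 1) * suc z
  regroup = solve-∀

[1+z*2]%2≡1 : ∀ z → (1 + z * 2) % 2 ≡ 1
[1+z*2]%2≡1 z = [m+kn]%n≡m%n 1 z 2

T-odd+1 : ∀ ν z → T ν (1 + z * 2) + 1 ≡ aν ν * suc z
T-odd+1 ν z rewrite [1+z*2]%2≡1 z =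
  [[P+1]*[1+z*2]+[P∸1]]/2+1≡[P+1]*[1+z] (2 ^ ν) z (m^n>0 2 ν)

T-shift : ∀ ν {y} v → y + 1 ≡ v * 2 → T ν y + 1 ≡ aν ν * v
T-shift ν {y} 0       y+1≡0  = ⊥-elim (m+1+n≢0 y y+1≡0)
T-shift ν {y} (suc z) y+1≡2v
  rewrite suc-injective (trans (+-comm 1 y) y+1≡2v) = T-odd+1 ν z

iter-T-shift : ∀ ν k {x} w → x + 1 ≡ 2 ^ k * w → iter (T ν) k x + 1 ≡ aν ν ^ k * w
iter-T-shift ν 0       w x+1≡w = x+1≡w
iter-T-shift ν (suc k) {x} w x+1≡2^[1+k]w = begin
    T ν (iter (T ν) k x) + 1   ≡⟨ T-shift ν (aν ν ^ k * w) ih ⟩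
    aν ν * (aν ν ^ k * w)      ≡⟨ sym (*-assoc (aν ν) (aν ν ^ k) w) ⟩
    aν ν ^ suc k * w           ∎
  where
  open ≡-Reasoning
  regroup : ∀ q w → 2 * q * w ≡ q * (w * 2)
  regroup = solve-∀
  ih : iter (T ν) k x + 1 ≡ aν ν ^ k * w * 2
  ih = trans (iter-T-shift ν k (w * 2) (trans x+1≡2^[1+k]w (regroup (2 ^ k) w)))
             (sym (*-assoc (aν ν ^ k) w 2))

iter-T-[2^k∸1]+1 : ∀ ν k → iter (T ν) k (2 ^ k ∸ 1) + 1 ≡ aν ν ^ k
iter-T-[2^k∸1]+1 ν k =
  trans (iter-T-shift ν k 1 (trans (m∸n+n≡m (m^n>0 2 k)) (sym (*-identityʳ (2 ^ k)))))
        (*-identityʳ (aν ν ^ k))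

3≤aν : ∀ {ν} → ν ≥ 1 → 3 ≤ aν ν
3≤aν ν≥1 = +-monoˡ-≤ 1 (^-monoʳ-≤ 2 ν≥1)

2^k*[k+2]≤2*3^k : ∀ k → 2 ^ k * (k + 2) ≤ 2 * 3 ^ k
2^k*[k+2]≤2*3^k 0       = ≤-refl
2^k*[k+2]≤2*3^k (suc k) = begin
    2 * 2 ^ k * (suc k + 2)               ≡⟨ expand (2 ^ k) k ⟩
    2 * (2 ^ k * (k + 2)) + 2 ^ k * 2     ≤⟨ +-monoʳ-≤ (2 * (2 ^ k * (k + 2))) (*-monoʳ-≤ (2 ^ k) (m≤n+m 2 k)) ⟩
    2 * (2 ^ k * (k + 2)) + 2 ^ k * (k + 2) ≤⟨ +-mono-≤ (*-monoʳ-≤ 2 ih) ih ⟩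
    2 * (2 * 3 ^ k) + 2 * 3 ^ k           ≡⟨ collect (3 ^ k) ⟩
    2 * (3 * 3 ^ k)                       ∎
  where
  open ≤-Reasoning
  ih : 2 ^ k * (k + 2) ≤ 2 * 3 ^ k
  ih = 2^k*[k+2]≤2*3^k k
  expand : ∀ q k → 2 * q * (suc k + 2) ≡ 2 * (q * (k + 2)) + q * 2
  expand = solve-∀
  collect : ∀ q → 2 * (2 * q) + 2 * q ≡ 2 * (3 * q)
  collect = solve-∀

2^[2+2m]*[m+2]≤3^[2+2m] : ∀ m → 2 ^ (2 + 2 * m) * (m + 2) ≤ 3 ^ (2 + 2 * m)
2^[2+2m]*[m+2]≤3^[2+2m] m = *-cancelˡ-≤ 2
  (subst (_≤ 2 * 3 ^ (2 + 2 * m)) (double (2 ^ (2 + 2 * m)) m) (2^k*[k+2]≤2*3^k (2 + 2 * m)))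
  where
  double : ∀ P m → P * (2 + 2 * m + 2) ≡ 2 * (P * (m + 2))
  double = solve-∀

mainTheorem9 : (ν : ℕ) → ν ≥ 1 →
    (M : ℕ) → ∃[ n ] (n ≥ 1 × ∃[ k ] (M * n < iter (T ν) k n))
mainTheorem9 ν ν≥1 M = n , n≥1 , k , +-cancelʳ-< 1 (M * n) _ climbs
  where
  k = 2 + 2 * M
  n = 2 ^ k ∸ 1
  n≥1 : n ≥ 1
  n≥1 = ∸-monoˡ-≤ 1 (^-monoʳ-≤ 2 {1} {k} (s≤s z≤n))
  climbs : M * n + 1 < iter (T ν) k n + 1
  climbs = begin-strict
    M * n + 1               <⟨ +-mono-≤-< (*-monoʳ-≤ M (m∸n≤m (2 ^ k) 1)) (*-monoʳ-≤ 2 (m^n>0 2 k)) ⟩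
    M * 2 ^ k + 2 * 2 ^ k   ≡⟨ *-distribʳ-+ (2 ^ k) M 2 ⟨
    (M + 2) * 2 ^ k         ≡⟨ *-comm (M + 2) (2 ^ k) ⟩
    2 ^ k * (M + 2)         ≤⟨ 2^[2+2m]*[m+2]≤3^[2+2m] M ⟩
    3 ^ k                   ≤⟨ ^-monoˡ-≤ k (3≤aν ν≥1) ⟩
    aν ν ^ k                ≡⟨ iter-T-[2^k∸1]+1 ν k ⟨
    iter (T ν) k n + 1      ∎
    where open ≤-Reasoning
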